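{- For every positive integer $k$, $2\left(\left\lceil \frac{3}{4}k\right\rceil -1\right) + 1 \leq m_{\mathcal{A}^*}(k)$.
   Context: An axis-parallel strip in $\mathbb{R}^2$ is a set of the form $\{(x,y): x_0<x<x_1\}$ or $\{(x,y): y_0<y<y_1\}$. The family $\mathcal{A}^*$ consists of the hypergraphs whose vertex set is a finite set of axis-parallel strips and each of whose edges is the set of all vertex-strips containing some given point $(x,y)\in\mathbb{R}^2$. A polychromatic $k$-coloring of a hypergraph is a coloring of its vertices with $k$ colors such that every edge contains a vertex of each of the $k$ colors. For a hypergraph $H$, $H_{\ge m}$ is obtained from $H$ by deleting all edges of size less than $m$. For a hypergraph family $\mathcal{H}$, $m_{\mathcal{H}}(k)$ is the smallest positive integer $m$ such that $H_{\ge m}$ has a polychromatic $k$-coloring for every $H\in\mathcal{H}$, and $m_{\mathcal{H}}(k)=\infty$ if no such $m$ exists. -}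

module Defs where

open import Data.Nat as ℕ using (ℕ; _+_; _*_; _∸_)
open import Data.Nat.DivMod using (_/_)
open import Data.Rational using (ℚ; _<_)
open import Data.Rational.Properties using (_<?_)
open import Data.Product using (_×_; _,_; Σ; ∃)
open import Data.Fin using (Fin)
open import Data.Fin.Subset using (Subset; ∣_∣)
open import Data.Vec using (tabulate)
open import Data.Empty using (⊥)
open import Data.Unit using (⊤)
open import Relation.Nullary using (Dec; yes; no; does; ¬_)
open import Relation.Nullary.Decidable using (_×-dec_)
open import Relation.Binary.PropositionalEquality using (_≡_)
open import Function.Definitions using (Injective)

-- ⌈ a / b ⌉ for b > 0, here only used as ⌈ 3k/4 ⌉ = ⌊ (3k+3)/4 ⌋
ceil3k/4 : ℕ → ℕ
ceil3k/4 k = (3 * k + 3) / 4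

-- An axis-parallel strip:  vert a b = {(x,y) : a < x < b},
--                          horiz a b = {(x,y) : a < y < b}.
-- Coordinates are rationals.
data Strip : Set where
  vert  : ℚ → ℚ → Strip
  horiz : ℚ → ℚ → Strip

-- Nondegenerate (nonempty) strip: a < b, so distinct codes are distinct sets.
WF : Strip → Set
WF (vert a b)  = a < b
WF (horiz a b) = a < b

Point : Set
Point = ℚ × ℚ

_∈S_ : Point → Strip → Set
(x , y) ∈S vert a b  = (a < x) × (x < b)
(x , y) ∈S horiz a b = (a < y) × (y < b)

_∈S?_ : (p : Point) → (s : Strip) → Dec (p ∈S s)
(x , y) ∈S? vert a b  = (a <? x) ×-dec (x <? b)
(x , y) ∈S? horiz a b = (a <? y) ×-dec (y <? b)

-- A hypergraph of 𝒜* on n vertices is given by n pairwise distinct strips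
-- S : Fin n → Strip; its edges are the sets edge S p for points p.
edge : ∀ {n} → (Fin n → Strip) → Point → Subset n
edge S p = tabulate (λ i → does (p ∈S? S i))

PolychromaticGe : (k m : ℕ) → ∀ {n} → (Fin n → Strip) → (Fin n → Fin k) → Set
PolychromaticGe k m S c =
  (p : Point) → m ℕ.≤ ∣ edge S p ∣ →
  (col : Fin k) → ∃ λ i → (p ∈S S i) × (c i ≡ col)

HasPolyColoring : (k m : ℕ) → ∀ {n} → (Fin n → Strip) → Set
HasPolyColoring k m S = ∃ λ c → PolychromaticGe k m S c

AllPoly : (k m : ℕ) → Set
AllPoly k m = (n : ℕ) (S : Fin n → Strip) →
  Injective _≡_ _≡_ S → ((i : Fin n) → WF (S i)) → HasPolyColoring k m S

-- Take t = ⌈3k/4⌉ − 1 strips of each of four kinds: vertical strips containing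
-- the abscissae −1 and 1 but not 3, vertical strips containing 1 and 3 but not
-- −1, and the two horizontal analogues.  For any two kinds some point lies in
-- exactly the 2t strips of these kinds, so if m ≤ 2t every colour class meets
-- every pair of kinds, i.e. at least three of the four kinds.  The k colour
-- classes are disjoint, giving 3k ≤ 4t, whereas 4t < 3k.
module Submission where

open import Defs
open import Data.Nat using (ℕ; _+_; _*_; _∸_; _≤_; _<_)
open import Relation.Nullary using (¬_)

open import Data.Nat using (suc; z≤n; s≤s)
open import Data.Nat.Properties
  using (<-asym; <⇒≱; ≤-trans; ≤-refl; ≤-reflexive; +-comm; *-comm; *-distribʳ-∸;
         ∸-monoˡ-≤; m+n∸n≡m; m<1+n⇒m≤n; module ≤-Reasoning)
open import Data.Nat.DivMod using (m/n*n≤m)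
open import Data.Integer as ℤ using (ℤ; +_; -[1+_])
import Data.Integer.Properties as ℤ
open import Data.Rational as ℚ using (ℚ; mkℚ)
open import Data.Rational.Base using (*<*)
import Data.Nat.Coprimality as Coprime
open import Data.Bool using (Bool; true; false; T; _∨_)
open import Data.Bool.Properties using (T-∨)
open import Data.Fin using (Fin; zero; suc; toℕ; punchIn; combine; remQuot; _≟_)
open import Data.Fin.Patterns using (0F; 1F; 2F; 3F)
open import Data.Fin.Properties
  using (injective⇒≤; combine-remQuot; remQuot-combine; combine-injective;
         punchIn-injective; punchInᵢ≢i; suc-injective; toℕ-injective; toℕ<n;
         ¬∀⟶∃¬; all?; any?)
open import Data.Fin.Subset using (Subset; inside; outside; _∈_; ∣_∣)
open import Data.Vec using (_∷_; here; there)
open import Data.Vec.Properties using (lookup⇒[]=; lookup∘tabulate)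
open import Data.Product using (_×_; _,_; ∃; proj₁; proj₂; uncurry)
import Data.Product as Product
open import Data.Sum as Sum using (_⊎_; inj₁; inj₂)
open import Data.Empty using (⊥-elim)
open import Function using (_∘_; Equivalence)
open import Function.Definitions using (Injective)
import Function.Construct.Composition as Comp
open import Relation.Nullary using (yes; no; contradiction)
open import Relation.Nullary.Decidable using (⌊_⌋; dec-true; toWitness; fromWitness; _×-dec_)
open import Relation.Unary using (Pred; Decidable)
open import Relation.Binary.PropositionalEquality

private variable
  m n : ℕ

rank : (p : Subset n) {i : Fin n} → i ∈ p → Fin ∣ p ∣
rank (inside ∷ p) here = zero
rank (inside ∷ p) (there i∈p) = suc (rank p i∈p)
rank (outside ∷ p) (there i∈p) = rank p i∈p

rank-injective : (p : Subset n) {i j : Fin n} (i∈p : i ∈ p) (j∈p : j ∈ p) →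
                 rank p i∈p ≡ rank p j∈p → i ≡ j
rank-injective (inside ∷ p) here here _ = refl
rank-injective (inside ∷ p) (there i∈p) (there j∈p) eq =
  cong suc (rank-injective p i∈p j∈p (suc-injective eq))
rank-injective (outside ∷ p) (there i∈p) (there j∈p) eq =
  cong suc (rank-injective p i∈p j∈p eq)

remQuot-injective : ∀ {n} k → Injective _≡_ _≡_ (remQuot {n} k)
remQuot-injective {n} k {i} {j} eq = begin
  i                                  ≡⟨ combine-remQuot {n} k i ⟨
  uncurry combine (remQuot {n} k i)  ≡⟨ cong (uncurry combine) eq ⟩
  uncurry combine (remQuot {n} k j)  ≡⟨ combine-remQuot {n} k j ⟩
  j                                  ∎
  where open ≡-Reasoning

injective⇒≤∣p∣ : (p : Subset n) {f : Fin m → Fin n} → Injective _≡_ _≡_ f →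
                 (∀ j → f j ∈ p) → m ≤ ∣ p ∣
injective⇒≤∣p∣ p {f} f-inj f∈p =
  injective⇒≤ λ eq → f-inj (rank-injective p (f∈p _) (f∈p _) eq)

colourClasses⇒≤ : ∀ {n k d} (c : Fin n → Fin k) (h : Fin k → Fin d → Fin n) →
            (∀ col → Injective _≡_ _≡_ (h col)) → (∀ col s → c (h col s) ≡ col) →
            k * d ≤ n
colourClasses⇒≤ {k = k} {d} c h h-inj h-col =
  injective⇒≤ (Comp.injective _≡_ _≡_ _≡_ (remQuot-injective {k} d) uncurry-h-injective)
  where
  uncurry-h-injective : Injective _≡_ _≡_ (uncurry h)
  uncurry-h-injective {a , s} {b , t} eq
    with refl ← trans (sym (h-col a s)) (trans (cong c eq) (h-col b t))
    = cong (a ,_) (h-inj a eq)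

pairCover⇒allButOne : ∀ {ℓ} {P : Pred (Fin (suc n)) ℓ} → Decidable P →
  (∀ {a b} → a ≢ b → P a ⊎ P b) → ∃ λ a → ∀ s → P (punchIn a s)
pairCover⇒allButOne {n} {P = P} P? cover with all? P?
... | yes all = zero , λ s → all _
... | no ¬all with ¬∀⟶∃¬ _ P P? ¬all
...   | a , ¬Pa = a , λ s → hit s (cover (punchInᵢ≢i a s))
  where
  hit : ∀ s → P (punchIn a s) ⊎ P a → P (punchIn a s)
  hit s (inj₁ p) = p
  hit s (inj₂ p) = contradiction p ¬Pa

fromℤ : ℤ → ℚ
fromℤ z = mkℚ z 0 (Coprime.sym (Coprime.1-coprimeTo _))

fromℤ-mono-< : ∀ {z w} → z ℤ.< w → fromℤ z ℚ.< fromℤ w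
fromℤ-mono-< {z} {w} z<w = *<* (subst₂ ℤ._<_ (sym (ℤ.*-identityʳ z)) (sym (ℤ.*-identityʳ w)) z<w)

fromℤ-cancel-< : ∀ {z w} → fromℤ z ℚ.< fromℤ w → z ℤ.< w
fromℤ-cancel-< {z} {w} (*<* z<w) = subst₂ ℤ._<_ (ℤ.*-identityʳ z) (ℤ.*-identityʳ w) z<w

Between : ℚ → ℚ → ℚ → Set
Between a b x = (a ℚ.< x) × (x ℚ.< b)

lower upper : ℕ → ℚ
lower v = fromℤ -[1+ suc v ]
upper v = fromℤ (+ (4 + v))

-- Kinds 0F, 1F are vertical and 2F, 3F horizontal, each as a lower strip
-- (−(v+2), 2) and an upper strip (0, v+4); the level v only serves to make the
-- strips pairwise distinct.
strip : ℕ → Fin 4 → Strip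
strip v 0F = vert  (lower v) (fromℤ (+ 2))
strip v 1F = vert  (fromℤ (+ 0)) (upper v)
strip v 2F = horiz (lower v) (fromℤ (+ 2))
strip v 3F = horiz (fromℤ (+ 0)) (upper v)

strip-wf : ∀ v r → WF (strip v r)
strip-wf v 0F = fromℤ-mono-< ℤ.-<+
strip-wf v 1F = fromℤ-mono-< (ℤ.+<+ (s≤s z≤n))
strip-wf v 2F = fromℤ-mono-< ℤ.-<+
strip-wf v 3F = fromℤ-mono-< (ℤ.+<+ (s≤s z≤n))

strip-injective : ∀ {v w r s} → strip v r ≡ strip w s → (v , r) ≡ (w , s)
strip-injective {r = 0F} {s = 0F} refl = refl
strip-injective {r = 1F} {s = 1F} refl = refl
strip-injective {r = 2F} {s = 2F} refl = refl
strip-injective {r = 3F} {s = 3F} refl = refl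
strip-injective {r = 0F} {s = 1F} ()
strip-injective {r = 1F} {s = 0F} ()
strip-injective {r = 2F} {s = 3F} ()
strip-injective {r = 3F} {s = 2F} ()
strip-injective {r = 0F} {s = 2F} ()
strip-injective {r = 0F} {s = 3F} ()
strip-injective {r = 1F} {s = 2F} ()
strip-injective {r = 1F} {s = 3F} ()
strip-injective {r = 2F} {s = 0F} ()
strip-injective {r = 2F} {s = 1F} ()
strip-injective {r = 3F} {s = 0F} ()
strip-injective {r = 3F} {s = 1F} ()

-- coord t l h lies in the lower strips iff l and in the upper strips iff h, as
-- long as the level is below t: −(t+2) is left of every such lower strip.
coord : ℕ → Bool → Bool → ℚ
coord t true  true  = fromℤ (+ 1)
coord t true  false = fromℤ -[1+ 0 ]
coord t false true  = fromℤ (+ 3)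
coord t false false = fromℤ -[1+ suc t ]

coord∈lower : ∀ {t v} l h → T l → Between (lower v) (fromℤ (+ 2)) (coord t l h)
coord∈lower true true  _ = fromℤ-mono-< ℤ.-<+ , fromℤ-mono-< (ℤ.+<+ (s≤s (s≤s z≤n)))
coord∈lower true false _ = fromℤ-mono-< (ℤ.-<- (s≤s z≤n)) , fromℤ-mono-< ℤ.-<+

coord∈lower⁻ : ∀ {t v} l h → v < t → Between (lower v) (fromℤ (+ 2)) (coord t l h) → T l
coord∈lower⁻ true  _     _   _ = _
coord∈lower⁻ false true  _   (_ , 3<2) with fromℤ-cancel-< 3<2
... | ℤ.+<+ (s≤s (s≤s ()))
coord∈lower⁻ false false v<t (lower<x , _) with fromℤ-cancel-< lower<x
... | ℤ.-<- (s≤s t<v) = ⊥-elim (<-asym v<t t<v)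

coord∈upper : ∀ {t v} l h → T h → Between (fromℤ (+ 0)) (upper v) (coord t l h)
coord∈upper true  true _ = fromℤ-mono-< (ℤ.+<+ (s≤s z≤n)) , fromℤ-mono-< (ℤ.+<+ (s≤s (s≤s z≤n)))
coord∈upper false true _ = fromℤ-mono-< (ℤ.+<+ (s≤s z≤n)) , fromℤ-mono-< (ℤ.+<+ (s≤s (s≤s (s≤s (s≤s z≤n)))))

coord∈upper⁻ : ∀ {t v} l h → Between (fromℤ (+ 0)) (upper v) (coord t l h) → T h
coord∈upper⁻ _     true  _ = _
coord∈upper⁻ true  false (0<-1 , _) with fromℤ-cancel-< 0<-1
... | ()
coord∈upper⁻ false false (0<x , _) with fromℤ-cancel-< 0<x
... | ()

pointFor : ℕ → (Fin 4 → Bool) → Point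
pointFor t U = coord t (U 0F) (U 1F) , coord t (U 2F) (U 3F)

pointFor-∈strip : ∀ {t v} U r → T (U r) → pointFor t U ∈S strip v r
pointFor-∈strip U 0F = coord∈lower (U 0F) (U 1F)
pointFor-∈strip U 1F = coord∈upper (U 0F) (U 1F)
pointFor-∈strip U 2F = coord∈lower (U 2F) (U 3F)
pointFor-∈strip U 3F = coord∈upper (U 2F) (U 3F)

pointFor-∈strip⁻ : ∀ {t v} U r → v < t → pointFor t U ∈S strip v r → T (U r)
pointFor-∈strip⁻ U 0F v<t = coord∈lower⁻ (U 0F) (U 1F) v<t
pointFor-∈strip⁻ U 1F _   = coord∈upper⁻ (U 0F) (U 1F)
pointFor-∈strip⁻ U 2F v<t = coord∈lower⁻ (U 2F) (U 3F) v<t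
pointFor-∈strip⁻ U 3F _   = coord∈upper⁻ (U 2F) (U 3F)

layer : ∀ t → Fin (t * 4) → Fin t
layer t i = proj₁ (remQuot {t} 4 i)

kind : ∀ t → Fin (t * 4) → Fin 4
kind t i = proj₂ (remQuot {t} 4 i)

arrangement : (t : ℕ) → Fin (t * 4) → Strip
arrangement t i = strip (toℕ (layer t i)) (kind t i)

arrangement-injective : ∀ t → Injective _≡_ _≡_ (arrangement t)
arrangement-injective t eq = remQuot-injective {t} 4
  (cong₂ _,_ (toℕ-injective (cong proj₁ (strip-injective eq))) (cong proj₂ (strip-injective eq)))

arrangement-wf : ∀ t i → WF (arrangement t i)
arrangement-wf t i = strip-wf (toℕ (layer t i)) (kind t i)

kind-combine : ∀ {t} (v : Fin t) r → kind t (combine v r) ≡ r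
kind-combine v r = cong proj₂ (remQuot-combine v r)

pointFor-∈arrangement : ∀ {t} U i → T (U (kind t i)) → pointFor t U ∈S arrangement t i
pointFor-∈arrangement {t} U i = pointFor-∈strip U (kind t i)

pointFor-∈arrangement⁻ : ∀ {t} U i → pointFor t U ∈S arrangement t i → T (U (kind t i))
pointFor-∈arrangement⁻ {t} U i = pointFor-∈strip⁻ U (kind t i) (toℕ<n (layer t i))

∈edge : ∀ {S : Fin n → Strip} {p i} → p ∈S S i → i ∈ edge S p
∈edge {S = S} {p} {i} p∈Si =
  lookup⇒[]= i (edge S p) (trans (lookup∘tabulate _ i) (dec-true (p ∈S? S i) p∈Si))

edge-lowerBound : ∀ {t c} U {ι : Fin c → Fin 4} → Injective _≡_ _≡_ ι → (∀ s → T (U (ι s))) →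
                  t * c ≤ ∣ edge (arrangement t) (pointFor t U) ∣
edge-lowerBound {t} {c} U {ι} ι-inj ι∈U = injective⇒≤∣p∣ _ f-inj f∈edge
  where
  f : Fin (t * c) → Fin (t * 4)
  f j = uncurry combine (Product.map₂ ι (remQuot {t} c j))
  f-inj : Injective _≡_ _≡_ f
  f-inj {j} {j′} eq
    with v≡ , s≡ ← combine-injective (proj₁ (remQuot {t} c j)) _ (proj₁ (remQuot {t} c j′)) _ eq
    = remQuot-injective {t} c (cong₂ _,_ v≡ (ι-inj s≡))
  f∈edge : ∀ j → f j ∈ edge (arrangement t) (pointFor t U)
  f∈edge j = ∈edge {S = arrangement t} (pointFor-∈arrangement U (f j)
    (subst (T ∘ U) (sym (kind-combine {t} _ _)) (ι∈U (proj₂ (remQuot {t} c j)))))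

pair : Fin n → Fin n → Fin 2 → Fin n
pair a b 0F = a
pair a b 1F = b

pair-injective : ∀ {a b : Fin n} → a ≢ b → Injective _≡_ _≡_ (pair a b)
pair-injective _   {0F} {0F} _  = refl
pair-injective a≢b {0F} {1F} eq = contradiction eq a≢b
pair-injective a≢b {1F} {0F} eq = contradiction (sym eq) a≢b
pair-injective _   {1F} {1F} _  = refl

-- ⌊_⌋ rather than does, so that toWitness and fromWitness apply.
pairSet : Fin n → Fin n → Fin n → Bool
pairSet a b r = ⌊ r ≟ a ⌋ ∨ ⌊ r ≟ b ⌋

pairSet-pair : ∀ (a b : Fin n) s → T (pairSet a b (pair a b s))
pairSet-pair a b 0F = Equivalence.from (T-∨ {⌊ a ≟ a ⌋}) (inj₁ (fromWitness refl))
pairSet-pair a b 1F = Equivalence.from (T-∨ {⌊ b ≟ a ⌋}) (inj₂ (fromWitness refl))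

pairSet⁻ : ∀ {a b r : Fin n} → T (pairSet a b r) → r ≡ a ⊎ r ≡ b
pairSet⁻ {a = a} {b} {r} = Sum.map toWitness toWitness ∘ Equivalence.to (T-∨ {⌊ r ≟ a ⌋})

module ColourClasses {k m t} {c : Fin (t * 4) → Fin k}
  (poly : PolychromaticGe k m (arrangement t) c) (m≤t*2 : m ≤ t * 2) where

  UsesKind : Fin k → Fin 4 → Set
  UsesKind col r = ∃ λ i → c i ≡ col × kind t i ≡ r

  usesKind? : ∀ col → Decidable (UsesKind col)
  usesKind? col r = any? λ i → (c i ≟ col) ×-dec (kind t i ≟ r)

  usesKind-pair : ∀ col {a b} → a ≢ b → UsesKind col a ⊎ UsesKind col b
  usesKind-pair col {a} {b} a≢b
    with i , p∈Sᵢ , cᵢ ← poly (pointFor t (pairSet a b))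
      (≤-trans m≤t*2 (edge-lowerBound {t} (pairSet a b) (pair-injective a≢b) (pairSet-pair a b))) col
    = Sum.map (λ i≡a → i , cᵢ , i≡a) (λ i≡b → i , cᵢ , i≡b)
        (pairSet⁻ (pointFor-∈arrangement⁻ (pairSet a b) i p∈Sᵢ))

  module _ (col : Fin k) where
    cover : ∃ λ unused → ∀ s → UsesKind col (punchIn unused s)
    cover = pairCover⇒allButOne (usesKind? col) (usesKind-pair col)

    unused : Fin 4
    unused = proj₁ cover

    uses : ∀ s → UsesKind col (punchIn unused s)
    uses = proj₂ cover

    triple : Fin 3 → Fin (t * 4)
    triple s = proj₁ (uses s)

    triple-colour : ∀ s → c (triple s) ≡ col
    triple-colour s = proj₁ (proj₂ (uses s))

    triple-injective : Injective _≡_ _≡_ triple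
    triple-injective {s} {s′} eq = punchIn-injective unused s s′ (begin
      punchIn unused s   ≡⟨ proj₂ (proj₂ (uses s)) ⟨
      kind t (triple s)  ≡⟨ cong (kind t) eq ⟩
      kind t (triple s′) ≡⟨ proj₂ (proj₂ (uses s′)) ⟩
      punchIn unused s′  ∎)
      where open ≡-Reasoning

-- 3 * k + 3 ∸ 4 computes to k-1 + 2 * k + 3 ∸ 3 since k = suc k-1.
[ceil3k/4∸1]*4<k*3 : ∀ k → 1 ≤ k → (ceil3k/4 k ∸ 1) * 4 < k * 3
[ceil3k/4∸1]*4<k*3 k@(suc k-1) _ = begin-strict
  (ceil3k/4 k ∸ 1) * 4       ≡⟨ *-distribʳ-∸ 4 (ceil3k/4 k) 1 ⟩
  ceil3k/4 k * 4 ∸ 4         ≤⟨ ∸-monoˡ-≤ 4 (m/n*n≤m (3 * k + 3) 4) ⟩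
  (3 * k + 3) ∸ 4            ≡⟨ m+n∸n≡m (k-1 + 2 * k) 3 ⟩
  k-1 + 2 * k                <⟨ ≤-refl ⟩
  3 * k                      ≡⟨ *-comm 3 k ⟩
  k * 3                      ∎
  where open ≤-Reasoning

theorem2 : (k : ℕ) → 1 ≤ k →
    (m : ℕ) → 1 ≤ m → m < 2 * (ceil3k/4 k ∸ 1) + 1 → ¬ AllPoly k m
theorem2 k 1≤k m _ m<2t+1 allPoly =
  <⇒≱ ([ceil3k/4∸1]*4<k*3 k 1≤k) (colourClasses⇒≤ c triple triple-injective triple-colour)
  where
  t : ℕ
  t = ceil3k/4 k ∸ 1
  colouring : HasPolyColoring k m (arrangement t)
  colouring = allPoly (t * 4) (arrangement t) (arrangement-injective t) (arrangement-wf t)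
  c : Fin (t * 4) → Fin k
  c = proj₁ colouring
  m≤t*2 : m ≤ t * 2
  m≤t*2 = ≤-trans (m<1+n⇒m≤n (subst (m <_) (+-comm (2 * t) 1) m<2t+1)) (≤-reflexive (*-comm 2 t))
  open ColourClasses (proj₂ colouring) m≤t*2
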